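{- If $G$ is a chordal graph that has an $H$-appendix, then $G$ has a perfect elimination ordering in which the vertices of $H$ come first, i.e., before all vertices not in $H$.
   Context: A graph is chordal if every induced cycle has length three. A perfect elimination ordering is a linear ordering of the vertices such that every vertex forms a clique with its neighbors that precede it. A graph is 2-connected if it has at least three vertices and removing any one vertex leaves it connected. Let $H$ be a 2-connected graph with a vertex $x$ such that $H-x$ is 2-connected or a single edge. A graph $G$ has an $H$-appendix if $G$ is obtained from an arbitrary (not necessarily connected) graph $H'$ with at least two vertices by gluing $H$ onto $H'$, identifying the vertex $x$ of $H$ with a vertex of $H'$. -}

module Defs where

open import Data.Nat using (ℕ; zero; suc; _≤_)
open import Data.Fin using (Fin; toℕ; _<_)
open import Data.Bool using (Bool; true; false)
open import Data.Product using (Σ; ∃; _×_; _,_)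
open import Data.Sum using (_⊎_)
open import Data.Unit using (⊤)
open import Relation.Nullary using (¬_)
open import Relation.Binary.PropositionalEquality using (_≡_; _≢_)
open import Function.Definitions using (Injective)

record Graph (n : ℕ) : Set where
  field
    adj    : Fin n → Fin n → Bool
    sym    : ∀ u v → adj u v ≡ adj v u
    irrefl : ∀ v → adj v v ≡ false
open Graph public

Adj : ∀ {n} → Graph n → Fin n → Fin n → Set
Adj G u v = adj G u v ≡ true

data WalkIn {n} (G : Graph n) (P : Fin n → Set) : Fin n → Fin n → Set where
  here : ∀ {u} → P u → WalkIn G P u u
  step : ∀ {u w v} → P u → Adj G u w → WalkIn G P w v → WalkIn G P u v

ConnectedOn : ∀ {n} → Graph n → (Fin n → Set) → Set
ConnectedOn G P = ∀ u v → P u → P v → WalkIn G P u v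

TwoConnectedOn : ∀ {n} → Graph n → (Fin n → Set) → Set
TwoConnectedOn G P =
  (Σ (Fin _) λ a → Σ (Fin _) λ b → Σ (Fin _) λ c →
     P a × P b × P c × a ≢ b × a ≢ c × b ≢ c)
  × (∀ y → P y → ConnectedOn G (λ v → P v × v ≢ y))

TwoConnected : ∀ {n} → Graph n → Set
TwoConnected G = TwoConnectedOn G (λ _ → ⊤)

SingleEdgeOn : ∀ {n} → Graph n → (Fin n → Set) → Set
SingleEdgeOn G P =
  Σ (Fin _) λ a → Σ (Fin _) λ b →
    P a × P b × a ≢ b × Adj G a b × (∀ v → P v → v ≡ a ⊎ v ≡ b)

CycAdj : (k : ℕ) → Fin k → Fin k → Set
CycAdj k i j =
  (suc (toℕ i) ≡ toℕ j) ⊎ (suc (toℕ j) ≡ toℕ i)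
  ⊎ (toℕ i ≡ 0 × suc (toℕ j) ≡ k) ⊎ (toℕ j ≡ 0 × suc (toℕ i) ≡ k)

IsInducedCycle : ∀ {n} → Graph n → (k : ℕ) → (Fin k → Fin n) → Set
IsInducedCycle G k c =
  3 ≤ k × Injective _≡_ _≡_ c
  × (∀ i j → (Adj G (c i) (c j) → CycAdj k i j) × (CycAdj k i j → Adj G (c i) (c j)))

Chordal : ∀ {n} → Graph n → Set
Chordal G = ∀ k c → IsInducedCycle G k c → k ≡ 3

-- pos v = position of v in a linear ordering of the vertices (pos injective,
-- hence a bijection Fin n → Fin n).  Perfect elimination: the neighbours of v
-- preceding v are pairwise adjacent.
IsPEO : ∀ {n} → Graph n → (Fin n → Fin n) → Set
IsPEO G pos = Injective _≡_ _≡_ pos ×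
  (∀ v u w → Adj G u v → Adj G w v → pos u < pos v → pos w < pos v → u ≢ w → Adj G u w)

-- G has an H-appendix (with respect to the vertex x of H), realised by the
-- embedding f of V(H) into V(G): G is H' glued to H at x, where H' is the
-- subgraph induced by (V(G) ∖ f(V(H))) ∪ {f x}.
HasAppendix : ∀ {n m} → Graph n → Graph m → Fin m → (Fin m → Fin n) → Set
HasAppendix G H x f =
  Injective _≡_ _≡_ f
  × (∀ a b → adj G (f a) (f b) ≡ adj H a b)
  × (∀ a v → a ≢ x → (∀ b → f b ≢ v) → adj G (f a) v ≡ false)
  × (Σ (Fin _) λ v → ∀ b → f b ≢ v)

{-# OPTIONS --safe #-}
module Submission where

-- A perfect elimination ordering is built from the back, each time putting last a simplicial
-- vertex of the subgraph induced by the vertices not yet placed. While a vertex outside H remains,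
-- such a vertex can be found outside H: H meets the rest of G only in x, so Dirac's lemma, applied
-- to the remaining vertices outside H together with x and to the clique {x}, yields a simplicial
-- vertex v ≠ x there, and all neighbours of v among the remaining vertices lie in that set.
-- Dirac's lemma (in a chordal graph, for every clique C and vertex w ∉ C some vertex outside C is
-- simplicial) is proved by induction: take u with C ⊆ N[u]; either u is adjacent to all other
-- vertices and can be removed, or a component K of the vertices outside N[u] has a boundary of
-- neighbours of u that is a clique, since two non-adjacent ones would close a chordless cycle
-- through u and K, and the induction applies to K together with its boundary.

open import Defs hiding (sym)
open import Data.Bool using (true)
import Data.Bool as Bool
open import Data.Empty using (⊥-elim)
open import Data.Fin using (Fin; zero; suc; toℕ; fromℕ; fromℕ<; _<_)
open import Data.Fin.Properties using (any?; toℕ-injective; toℕ-fromℕ; toℕ-fromℕ<) renaming (_≟_ to _≟ᶠ_)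
open import Data.Fin.Subset using (Subset; _∈_; _∉_; _⊆_; _⊂_; _⊃_; _─_; _-_; _∪_; ⁅_⁆; ⊤; outside; ∣_∣)
open import Data.Fin.Subset.Induction using (⊃-wellFounded; ⊂-wellFounded; Acc; acc)
open import Data.Fin.Subset.Properties using (_∈?_; nonempty?; ∉⊥; ∈⊤; ⊆⊤; ∣⊤∣≡n; x∈⁅x⁆; x∈⁅y⁆⇒x≡y; x∉⁅y⁆⇒x≢y; p─q⊆p; x∈p∧x∉q⇒x∈p─q; x∈p∧x≢y⇒x∈p-y; x∈p∪q⁻; p⊆p∪q; q⊆p∪q; x∈p⇒p-x⊂p; x∈p⇒∣p-x∣<∣p∣)
open import Data.List using (List; []; _∷_; length; lookup)
open import Data.List.Membership.Propositional.Properties using (∈-lookup)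
open import Data.List.Relation.Unary.All as All using (All; []; _∷_)
open import Data.List.Relation.Unary.All.Properties using (¬Any⇒All¬)
open import Data.List.Relation.Unary.Any as Any using (Any; here; there)
open import Data.Nat as ℕ using (ℕ; zero; suc; _+_; _≤_; s≤s; z≤n)
open import Data.Nat.Properties using (suc-injective; <-irrefl; <-trans)
open import Data.Product using (Σ; ∃-syntax; _×_; _,_; proj₁; proj₂)
open import Data.Sum as Sum using (_⊎_; inj₁; inj₂)
open import Data.Vec as Vec using (_∷_; tabulate)
open import Data.Vec.Properties using (lookup∘tabulate; lookup⇒[]=; []=⇒lookup)
open import Function using (_∘_; id)
open import Function.Definitions using (Injective)
open import Level using (0ℓ)
open import Relation.Binary.PropositionalEquality using (_≡_; _≢_; refl; sym; trans; cong; subst; subst₂)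
open import Relation.Nullary using (¬_; Dec; yes; no; contradiction)
open import Relation.Nullary.Decidable using (does; dec-true; decidable-stable; toSum; ¬?; _×-dec_; _⊎-dec_)
open import Relation.Unary using (Pred; Decidable)

x∈p─q⇒x∉q : ∀ {n x} {p q : Subset n} → x ∈ p ─ q → x ∉ q
x∈p─q⇒x∉q {p = _ ∷ _} {outside ∷ _} Vec.here ()
x∈p─q⇒x∉q {p = _ ∷ _} {_ ∷ _} (Vec.there x∈p─q) (Vec.there x∈q) = x∈p─q⇒x∉q x∈p─q x∈q

module _ {n : ℕ} where

  ⟦_⟧ : {P : Pred (Fin n) 0ℓ} → Decidable P → Subset n
  ⟦ P? ⟧ = tabulate (does ∘ P?)

  ∈⟦⟧⁺ : {P : Pred (Fin n) 0ℓ} (P? : Decidable P) {x : Fin n} → P x → x ∈ ⟦ P? ⟧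
  ∈⟦⟧⁺ P? {x} px = lookup⇒[]= x _ (trans (lookup∘tabulate _ x) (dec-true (P? x) px))

  ∈⟦⟧⁻ : {P : Pred (Fin n) 0ℓ} (P? : Decidable P) {x : Fin n} → x ∈ ⟦ P? ⟧ → P x
  ∈⟦⟧⁻ P? {x} x∈ with P? x | trans (sym (lookup∘tabulate (does ∘ P?) x)) ([]=⇒lookup x∈)
  ... | yes px | _ = px
  ... | no _ | ()

  x∈p-y⇒x≢y : ∀ {x y} {p : Subset n} → x ∈ p - y → x ≢ y
  x∈p-y⇒x≢y x∈p-y = x∉⁅y⁆⇒x≢y (x∈p─q⇒x∉q x∈p-y)

  p⊆q⇒p⊆q-x : ∀ {p q : Subset n} {x} → p ⊆ q → x ∉ p → p ⊆ q - x
  p⊆q⇒p⊆q-x p⊆q x∉p y∈p = x∈p∧x≢y⇒x∈p-y (p⊆q y∈p) (λ y≡x → x∉p (subst (_∈ _) y≡x y∈p))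

  saturate : (F : Subset n → Subset n) → (∀ {p} → p ⊆ F p)
           → (I : Pred (Subset n) 0ℓ) → (∀ {p} → I p → I (F p))
           → ∀ p → I p → ∃[ q ] p ⊆ q × F q ⊆ q × I q
  saturate F inflationary I preserved p = go p (⊃-wellFounded p)
    where
    go : ∀ p → Acc _⊃_ p → I p → ∃[ q ] p ⊆ q × F q ⊆ q × I q
    go p (acc rec) Ip with any? (λ x → x ∈? F p ×-dec ¬? (x ∈? p))
    ... | yes (x , x∈Fp , x∉p) with go (F p) (rec (inflationary , x , x∈Fp , x∉p)) (preserved Ip)
    ...   | q , Fp⊆q , Fq⊆q , Iq = q , Fp⊆q ∘ inflationary , Fq⊆q , Iq
    go p _ Ip | no stable =
      p , id , (λ {x} x∈Fp → decidable-stable (x ∈? p) (λ x∉p → stable (x , x∈Fp , x∉p))) , Ip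

Consecutive : ∀ {k} → Fin k → Fin k → Set
Consecutive i j = suc (toℕ i) ≡ toℕ j ⊎ suc (toℕ j) ≡ toℕ i

consecutive-sym : ∀ {k} {i j : Fin k} → Consecutive i j → Consecutive j i
consecutive-sym (inj₁ e) = inj₂ e
consecutive-sym (inj₂ e) = inj₁ e

cycAdj-sym : ∀ {k} {i j : Fin k} → CycAdj k i j → CycAdj k j i
cycAdj-sym (inj₁ e) = inj₂ (inj₁ e)
cycAdj-sym (inj₂ (inj₁ e)) = inj₁ e
cycAdj-sym (inj₂ (inj₂ (inj₁ e))) = inj₂ (inj₂ (inj₂ e))
cycAdj-sym (inj₂ (inj₂ (inj₂ e))) = inj₂ (inj₂ (inj₁ e))

¬cycAdj-zero-zero : ∀ {L} → ¬ CycAdj (suc (suc L)) zero zero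
¬cycAdj-zero-zero (inj₁ ())
¬cycAdj-zero-zero (inj₂ (inj₁ ()))
¬cycAdj-zero-zero (inj₂ (inj₂ (inj₁ (_ , ()))))
¬cycAdj-zero-zero (inj₂ (inj₂ (inj₂ (_ , ()))))

cycAdj-zero⁻ : ∀ {L} (j : Fin (suc L)) → CycAdj (suc (suc L)) zero (suc j) → toℕ j ≡ 0 ⊎ toℕ j ≡ L
cycAdj-zero⁻ j (inj₁ e) = inj₁ (sym (suc-injective e))
cycAdj-zero⁻ j (inj₂ (inj₂ (inj₁ (_ , e)))) = inj₂ (suc-injective (suc-injective e))

cycAdj-zero⁺ : ∀ {L} (j : Fin (suc L)) → toℕ j ≡ 0 ⊎ toℕ j ≡ L → CycAdj (suc (suc L)) zero (suc j)
cycAdj-zero⁺ j (inj₁ e) = inj₁ (cong suc (sym e))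
cycAdj-zero⁺ j (inj₂ e) = inj₂ (inj₂ (inj₁ (refl , cong (2 +_) e)))

cycAdj-suc⁻ : ∀ {k} {i j : Fin k} → CycAdj (suc k) (suc i) (suc j) → Consecutive i j
cycAdj-suc⁻ (inj₁ e) = inj₁ (suc-injective e)
cycAdj-suc⁻ (inj₂ (inj₁ e)) = inj₂ (suc-injective e)
cycAdj-suc⁻ (inj₂ (inj₂ (inj₁ (() , _))))
cycAdj-suc⁻ (inj₂ (inj₂ (inj₂ (() , _))))

cycAdj-suc⁺ : ∀ {k} {i j : Fin k} → Consecutive i j → CycAdj (suc k) (suc i) (suc j)
cycAdj-suc⁺ (inj₁ e) = inj₁ (cong suc e)
cycAdj-suc⁺ (inj₂ e) = inj₂ (inj₁ (cong suc e))

module _ {n : ℕ} (G : Graph n) where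

  Vertex : Set
  Vertex = Fin n

  adj-sym : ∀ {a b} → Adj G a b → Adj G b a
  adj-sym {a} {b} a~b = trans (Graph.sym G b a) a~b

  adj-irrefl : ∀ {a} → ¬ Adj G a a
  adj-irrefl {a} a~a with trans (sym a~a) (irrefl G a)
  ... | ()

  adj⇒≢ : ∀ {a b} → Adj G a b → a ≢ b
  adj⇒≢ a~b refl = adj-irrefl a~b

  adj? : ∀ a b → Dec (Adj G a b)
  adj? a b = adj G a b Bool.≟ true

  Near : Vertex → Vertex → Set
  Near z a = z ≡ a ⊎ Adj G z a

  near? : ∀ z a → Dec (Near z a)
  near? z a = (z ≟ᶠ a) ⊎-dec adj? z a

  adj-from-near : ∀ {z a} → Near z a → z ≢ a → Adj G z a
  adj-from-near (inj₁ z≡a) z≢a = contradiction z≡a z≢a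
  adj-from-near (inj₂ z~a) _ = z~a

  walk-start : ∀ {P a b} → WalkIn G P a b → P a
  walk-start (here pa) = pa
  walk-start (step pa _ _) = pa

  walk-end : ∀ {P a b} → WalkIn G P a b → P b
  walk-end (here pb) = pb
  walk-end (step _ _ w) = walk-end w

  walk-map : ∀ {P Q a b} → (∀ {z} → P z → Q z) → WalkIn G P a b → WalkIn G Q a b
  walk-map P⊆Q (here pa) = here (P⊆Q pa)
  walk-map P⊆Q (step pa a~c w) = step (P⊆Q pa) a~c (walk-map P⊆Q w)

  _++ʷ_ : ∀ {P a b c} → WalkIn G P a b → WalkIn G P b c → WalkIn G P a c
  here _ ++ʷ w′ = w′
  step pa a~c w ++ʷ w′ = step pa a~c (w ++ʷ w′)

  walk-reverse : ∀ {P a b} → WalkIn G P a b → WalkIn G P b a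
  walk-reverse (here pa) = here pa
  walk-reverse (step pa a~c w) = walk-reverse w ++ʷ step (walk-start w) (adj-sym a~c) (here pa)

  -- ChordlessPath q a vs: the list a ∷ vs is an induced path of G ending in q.
  data ChordlessPath (q : Vertex) : Vertex → List Vertex → Set where
    []   : ChordlessPath q q []
    link : ∀ {a b vs} → Adj G a b → All (¬_ ∘ Near a) vs → ChordlessPath q b vs
         → ChordlessPath q a (b ∷ vs)

  module _ {q : Vertex} where

    chordless-lookup-last : ∀ {a vs} → ChordlessPath q a vs → lookup (a ∷ vs) (fromℕ (length vs)) ≡ q
    chordless-lookup-last [] = refl
    chordless-lookup-last (link _ _ p) = chordless-lookup-last p

    near-head⇒next : ∀ {a vs} → ChordlessPath q a vs → ∀ j → Near a (lookup vs j) → toℕ j ≡ 0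
    near-head⇒next (link _ _ _) zero _ = refl
    near-head⇒next (link _ far _) (suc j) = ⊥-elim ∘ All.lookup far (∈-lookup j)

    next-adj-head : ∀ {a vs} → ChordlessPath q a vs → ∀ j → toℕ j ≡ 0 → Adj G a (lookup vs j)
    next-adj-head (link a~b _ _) zero _ = a~b

    chordless-injective : ∀ {a vs} → ChordlessPath q a vs → ∀ i j →
                          lookup (a ∷ vs) i ≡ lookup (a ∷ vs) j → i ≡ j
    chordless-injective p zero zero _ = refl
    chordless-injective p zero (suc j) a≡vⱼ =
      contradiction (subst (Adj G _) (sym a≡vⱼ) (next-adj-head p j (near-head⇒next p j (inj₁ a≡vⱼ))))
                    adj-irrefl
    chordless-injective p (suc i) zero vᵢ≡a = sym (chordless-injective p zero (suc i) (sym vᵢ≡a))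
    chordless-injective (link _ _ p) (suc i) (suc j) vᵢ≡vⱼ = cong suc (chordless-injective p i j vᵢ≡vⱼ)

    chordless-adj⇒consecutive : ∀ {a vs} → ChordlessPath q a vs → ∀ i j →
                                Adj G (lookup (a ∷ vs) i) (lookup (a ∷ vs) j) → Consecutive i j
    chordless-adj⇒consecutive p zero zero a~a = contradiction a~a adj-irrefl
    chordless-adj⇒consecutive p zero (suc j) a~vⱼ = inj₁ (cong suc (sym (near-head⇒next p j (inj₂ a~vⱼ))))
    chordless-adj⇒consecutive p (suc i) zero vᵢ~a =
      consecutive-sym (chordless-adj⇒consecutive p zero (suc i) (adj-sym vᵢ~a))
    chordless-adj⇒consecutive (link _ _ p) (suc i) (suc j) vᵢ~vⱼ =
      Sum.map (cong suc) (cong suc) (chordless-adj⇒consecutive p i j vᵢ~vⱼ)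

    consecutive⇒chordless-adj : ∀ {a vs} → ChordlessPath q a vs → ∀ i j →
                                Consecutive i j → Adj G (lookup (a ∷ vs) i) (lookup (a ∷ vs) j)
    consecutive⇒chordless-adj p zero (suc j) (inj₁ e) = next-adj-head p j (sym (suc-injective e))
    consecutive⇒chordless-adj p zero zero (inj₁ ())
    consecutive⇒chordless-adj p zero zero (inj₂ ())
    consecutive⇒chordless-adj p zero (suc j) (inj₂ ())
    consecutive⇒chordless-adj p (suc i) zero (inj₁ ())
    consecutive⇒chordless-adj p (suc i) zero (inj₂ e) = adj-sym (next-adj-head p i (sym (suc-injective e)))
    consecutive⇒chordless-adj (link _ _ p) (suc i) (suc j) c =
      consecutive⇒chordless-adj p i j (Sum.map suc-injective suc-injective c)

  module _ {P : Pred Vertex 0ℓ} {q : Vertex} where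

    -- a is linked to the last vertex of the path in N[a], and what precedes that vertex is dropped.
    chordless-prepend : ∀ {a b vs} → Any (Near a) (b ∷ vs) → ChordlessPath q b vs → All P (b ∷ vs)
                      → ∃[ ws ] ChordlessPath q a ws × All P ws
    chordless-prepend {a} {vs = vs} _ _ _ with Any.any? (near? a) vs
    chordless-prepend _ (link _ _ p) (_ ∷ Pvs) | yes nearLater = chordless-prepend nearLater p Pvs
    chordless-prepend (here (inj₁ refl)) p (_ ∷ Pvs) | no _ = _ , p , Pvs
    chordless-prepend (here (inj₂ a~b)) p Pvs | no farLater = _ , link a~b (¬Any⇒All¬ _ farLater) p , Pvs
    chordless-prepend (there nearLater) _ _ | no farLater = contradiction nearLater farLater

    walk⇒chordless : ∀ {a} → WalkIn G P a q → ∃[ vs ] ChordlessPath q a vs × All P (a ∷ vs)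
    walk⇒chordless (here pa) = [] , [] , pa ∷ []
    walk⇒chordless (step pa a~b w) with walk⇒chordless w
    ... | _ , p , Pvs with chordless-prepend (here (inj₂ a~b)) p Pvs
    ...   | ws , p′ , Pws = ws , p′ , pa ∷ Pws

  Detour : Vertex → Vertex → Vertex → Vertex → Set
  Detour u p q z = z ≡ p ⊎ z ≡ q ⊎ ¬ Near u z

  detour-cycle : ∀ {u p q vs} → ChordlessPath q p vs → Adj G u p → Adj G u q → p ≢ q
               → All (Detour u p q) (p ∷ vs) → IsInducedCycle G (suc (suc (length vs))) (lookup (u ∷ p ∷ vs))
  detour-cycle {u} {p} {q} {vs} path u~p u~q p≢q onDetour =
    long path , injective , λ i j → adj⇒cycAdj i j , cycAdj⇒adj i j
    where
    vertex : Fin (suc (length vs)) → Vertex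
    vertex = lookup (p ∷ vs)

    long : ∀ {ws} → ChordlessPath q p ws → 3 ≤ suc (suc (length ws))
    long [] = contradiction refl p≢q
    long (link _ _ _) = s≤s (s≤s (s≤s z≤n))

    apex-distinct : ∀ j → u ≢ vertex j
    apex-distinct j u≡v with All.lookup onDetour (∈-lookup j)
    ... | inj₁ v≡p = adj⇒≢ u~p (trans u≡v v≡p)
    ... | inj₂ (inj₁ v≡q) = adj⇒≢ u~q (trans u≡v v≡q)
    ... | inj₂ (inj₂ far) = far (inj₁ u≡v)

    apex-adj⇒end : ∀ j → Adj G u (vertex j) → toℕ j ≡ 0 ⊎ toℕ j ≡ length vs
    apex-adj⇒end j u~v with All.lookup onDetour (∈-lookup j)
    ... | inj₁ v≡p = inj₁ (cong toℕ (chordless-injective path j zero v≡p))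
    ... | inj₂ (inj₁ v≡q) =
      let vⱼ≡last = trans v≡q (sym (chordless-lookup-last path))
      in inj₂ (trans (cong toℕ (chordless-injective path j (fromℕ _) vⱼ≡last)) (toℕ-fromℕ _))
    ... | inj₂ (inj₂ far) = contradiction (inj₂ u~v) far

    end⇒apex-adj : ∀ j → toℕ j ≡ 0 ⊎ toℕ j ≡ length vs → Adj G u (vertex j)
    end⇒apex-adj j (inj₁ e) rewrite toℕ-injective {i = j} {j = zero} e = u~p
    end⇒apex-adj j (inj₂ e) rewrite toℕ-injective {i = j} (trans e (sym (toℕ-fromℕ _))) =
      subst (Adj G u) (sym (chordless-lookup-last path)) u~q

    injective : Injective _≡_ _≡_ (lookup (u ∷ p ∷ vs))
    injective {zero} {zero} _ = refl
    injective {zero} {suc j} e = contradiction e (apex-distinct j)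
    injective {suc i} {zero} e = contradiction (sym e) (apex-distinct i)
    injective {suc i} {suc j} e = cong suc (chordless-injective path i j e)

    adj⇒cycAdj : ∀ i j → Adj G (lookup (u ∷ p ∷ vs) i) (lookup (u ∷ p ∷ vs) j) → CycAdj _ i j
    adj⇒cycAdj zero zero u~u = contradiction u~u adj-irrefl
    adj⇒cycAdj zero (suc j) u~v = cycAdj-zero⁺ j (apex-adj⇒end j u~v)
    adj⇒cycAdj (suc i) zero v~u = cycAdj-sym (cycAdj-zero⁺ i (apex-adj⇒end i (adj-sym v~u)))
    adj⇒cycAdj (suc i) (suc j) v~v = cycAdj-suc⁺ (chordless-adj⇒consecutive path i j v~v)

    cycAdj⇒adj : ∀ i j → CycAdj _ i j → Adj G (lookup (u ∷ p ∷ vs) i) (lookup (u ∷ p ∷ vs) j)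
    cycAdj⇒adj zero zero c = contradiction c ¬cycAdj-zero-zero
    cycAdj⇒adj zero (suc j) c = end⇒apex-adj j (cycAdj-zero⁻ j c)
    cycAdj⇒adj (suc i) zero c = adj-sym (end⇒apex-adj i (cycAdj-zero⁻ i (cycAdj-sym c)))
    cycAdj⇒adj (suc i) (suc j) c = consecutive⇒chordless-adj path i j (cycAdj-suc⁻ c)

  record Component (T : Subset n) (w : Vertex) : Set where
    field
      members : Subset n
      root    : w ∈ members
      closed  : ∀ {k x} → k ∈ members → x ∈ T → Adj G k x → x ∈ members
      walk    : ∀ {x} → x ∈ members → WalkIn G (_∈ T) w x

  module _ {T : Subset n} {w : Vertex} (w∈T : w ∈ T) where

    private
      grow? : (q : Subset n) → Decidable (λ x → x ∈ q ⊎ x ∈ T × ∃[ k ] k ∈ q × Adj G k x)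
      grow? q x = x ∈? q ⊎-dec (x ∈? T ×-dec any? (λ k → k ∈? q ×-dec adj? k x))

      grow : Subset n → Subset n
      grow q = ⟦ grow? q ⟧

      Reached : Pred (Subset n) 0ℓ
      Reached q = ∀ {x} → x ∈ q → WalkIn G (_∈ T) w x

      reach-grow : ∀ {q} → Reached q → Reached (grow q)
      reach-grow {q} reached x∈ with ∈⟦⟧⁻ (grow? q) x∈
      ... | inj₁ x∈q = reached x∈q
      ... | inj₂ (x∈T , k , k∈q , k~x) = reached k∈q ++ʷ step (walk-end (reached k∈q)) k~x (here x∈T)

      reach-root : Reached ⁅ w ⁆
      reach-root x∈⁅w⁆ = subst (WalkIn G _ w) (sym (x∈⁅y⁆⇒x≡y w x∈⁅w⁆)) (here w∈T)

    -- Opaque so that type checking never unfolds the well-founded iteration behind the component.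
    opaque
      component : Component T w
      component with saturate grow (∈⟦⟧⁺ (grow? _) ∘ inj₁) Reached reach-grow ⁅ w ⁆ reach-root
      ... | K , w⊆K , grow-K⊆K , reached = record
        { members = K
        ; root    = w⊆K (x∈⁅x⁆ w)
        ; closed  = λ k∈K x∈T k~x → grow-K⊆K (∈⟦⟧⁺ (grow? K) (inj₂ (x∈T , _ , k∈K , k~x)))
        ; walk    = reached
        }

  IsClique : Subset n → Set
  IsClique C = ∀ {a b} → a ∈ C → b ∈ C → a ≢ b → Adj G a b

  Simplicial : Subset n → Vertex → Set
  Simplicial S v = ∀ {a b} → a ∈ S → b ∈ S → Adj G a v → Adj G b v → a ≢ b → Adj G a b

  simplicial-⊆ : ∀ {S S′ v} → (∀ {a} → a ∈ S → Adj G a v → a ∈ S′) → Simplicial S′ v → Simplicial S v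
  simplicial-⊆ N⊆S′ simplicial a∈S b∈S a~v b~v = simplicial (N⊆S′ a∈S a~v) (N⊆S′ b∈S b~v) a~v b~v

  Dominates : Vertex → Subset n → Set
  Dominates u S = ∀ {x} → x ∈ S → Near u x

  dominates? : ∀ S u → Dominates u S ⊎ ∃[ x ] x ∈ S × ¬ Near u x
  dominates? S u with any? (λ x → x ∈? S ×-dec ¬? (near? u x))
  ... | yes far = inj₂ far
  ... | no none = inj₁ λ {x} x∈S → decidable-stable (near? u x) (λ far → none (x , x∈S , far))

  clique-dominator : ∀ {S C w} → C ⊆ S → IsClique C → w ∈ S → ∃[ u ] u ∈ S × Dominates u C
  clique-dominator {C = C} {w} C⊆S clique w∈S with nonempty? C
  ... | yes (u , u∈C) = u , C⊆S u∈C , λ {c} c∈C → Sum.map₂ (clique u∈C c∈C) (toSum (u ≟ᶠ c))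
  ... | no empty = w , w∈S , λ c∈C → contradiction (_ , c∈C) empty

  simplicial-remove-dominating : ∀ {S u v} → Dominates u S → Simplicial (S - u) v → Simplicial S v
  simplicial-remove-dominating {u = u} dominates simplicial {a} {b} a∈S b∈S a~v b~v a≢b
    with a ≟ᶠ u | b ≟ᶠ u
  ... | yes refl | yes refl = contradiction refl a≢b
  ... | yes refl | no b≢u = adj-from-near (dominates b∈S) (b≢u ∘ sym)
  ... | no a≢u | yes refl = adj-sym (adj-from-near (dominates a∈S) (a≢u ∘ sym))
  ... | no a≢u | no b≢u = simplicial (x∈p∧x≢y⇒x∈p-y a∈S a≢u) (x∈p∧x≢y⇒x∈p-y b∈S b≢u) a~v b~v a≢b

  DiracProperty : Subset n → Set
  DiracProperty S = ∀ {C w} → C ⊆ S → IsClique C → w ∈ S → w ∉ C → ∃[ v ] v ∈ S × v ∉ C × Simplicial S v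

  dirac-dominating : ∀ {S u} → Dominates u S → DiracProperty (S - u) → DiracProperty S
  dirac-dominating {S} {u} dominates dirac-S-u {C} {w} C⊆S clique w∈S w∉C
    with any? (λ x → x ∈? S - u ×-dec ¬? (x ∈? C))
  ... | yes (t , t∈S-u , t∉C) =
    let v , v∈S-u , v∉C-u , simplicial = dirac-S-u {C - u} C-u⊆S-u clique-C-u t∈S-u (t∉C ∘ p─q⊆p _ _)
    in v , p─q⊆p _ _ v∈S-u , (λ v∈C → v∉C-u (x∈p∧x≢y⇒x∈p-y v∈C (x∈p-y⇒x≢y v∈S-u))) ,
       simplicial-remove-dominating dominates simplicial
    where
    C-u⊆S-u : C - u ⊆ S - u
    C-u⊆S-u x∈ = x∈p∧x≢y⇒x∈p-y (C⊆S (p─q⊆p _ _ x∈)) (x∈p-y⇒x≢y x∈)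

    clique-C-u : IsClique (C - u)
    clique-C-u a∈ b∈ = clique (p─q⊆p _ _ a∈) (p─q⊆p _ _ b∈)
  ... | no S-u⊆C = w , w∈S , w∉C , simplicial-⊆ N⊆C (λ a∈ b∈ _ _ → clique a∈ b∈)
    where
    in-C : ∀ {x} → x ∈ S → x ≢ u → x ∈ C
    in-C {x} x∈S x≢u = decidable-stable (x ∈? C) (λ x∉C → S-u⊆C (x , x∈p∧x≢y⇒x∈p-y x∈S x≢u , x∉C))

    w≡u : w ≡ u
    w≡u = decidable-stable (w ≟ᶠ u) (w∉C ∘ in-C w∈S)

    N⊆C : ∀ {a} → a ∈ S → Adj G a w → a ∈ C
    N⊆C a∈S a~w = in-C a∈S (λ a≡u → adj⇒≢ a~w (trans a≡u (sym w≡u)))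

  record EliminationOrder (S : Subset n) (pos : Vertex → ℕ) : Set where
    field
      injective : ∀ {a b} → a ∈ S → b ∈ S → pos a ≡ pos b → a ≡ b
      bounded   : ∀ {a} → a ∈ S → pos a ℕ.< ∣ S ∣
      perfect   : ∀ {v a b} → v ∈ S → a ∈ S → b ∈ S → Adj G a v → Adj G b v
                → pos a ℕ.< pos v → pos b ℕ.< pos v → a ≢ b → Adj G a b

  empty-elimination-order : ∀ {S} → (∀ {x} → x ∉ S) → EliminationOrder S (λ _ → 0)
  empty-elimination-order x∉S = record
    { injective = λ a∈S → contradiction a∈S x∉S
    ; bounded   = λ a∈S → contradiction a∈S x∉S
    ; perfect   = λ v∈S → contradiction v∈S x∉S
    }

  ComesFirst : Subset n → Subset n → (Vertex → ℕ) → Set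
  ComesFirst B S pos = ∀ {b x} → b ∈ B → x ∈ S → x ∉ B → pos b ℕ.< pos x

  placeLast : Vertex → ℕ → (Vertex → ℕ) → Vertex → ℕ
  placeLast v k pos x with x ≟ᶠ v
  ... | yes _ = k
  ... | no _ = pos x

  placeLast-self : ∀ {v k pos} → placeLast v k pos v ≡ k
  placeLast-self {v} with v ≟ᶠ v
  ... | yes _ = refl
  ... | no v≢v = contradiction refl v≢v

  placeLast-other : ∀ {v k pos x} → x ≢ v → placeLast v k pos x ≡ pos x
  placeLast-other {v} {x = x} x≢v with x ≟ᶠ v
  ... | yes x≡v = contradiction x≡v x≢v
  ... | no _ = refl

  module _ {S : Subset n} {v : Vertex} {pos : Vertex → ℕ} (v∈S : v ∈ S) where

    private
      pos′ : Vertex → ℕ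
      pos′ = placeLast v ∣ S - v ∣ pos

      data Placed (x : Vertex) : Set where
        last    : x ≡ v → pos′ x ≡ ∣ S - v ∣ → Placed x
        earlier : x ∈ S - v → pos′ x ≡ pos x → Placed x

      placed : ∀ {x} → x ∈ S → Placed x
      placed {x} x∈S with x ≟ᶠ v
      ... | yes refl = last refl (placeLast-self {v = v} {k = ∣ S - v ∣} {pos})
      ... | no x≢v = earlier (x∈p∧x≢y⇒x∈p-y x∈S x≢v) (placeLast-other x≢v)

    extend : Simplicial S v → EliminationOrder (S - v) pos → EliminationOrder S (placeLast v ∣ S - v ∣ pos)
    extend simplicial eo = record { injective = injective′ ; bounded = bounded′ ; perfect = perfect′ }
      where
      open EliminationOrder eo

      earlier-not-last : ∀ {x} → x ∈ S - v → pos′ x ≡ pos x → ¬ (pos′ x ≡ ∣ S - v ∣)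
      earlier-not-last x∈ e e′ = <-irrefl (trans (sym e) e′) (bounded x∈)

      earlier-before : ∀ {x y} → x ∈ S → y ∈ S - v → pos′ x ℕ.< pos′ y → x ∈ S - v × pos′ x ≡ pos x
      earlier-before {x} {y} x∈S y∈ lt with placed x∈S | placed {y} (p─q⊆p _ _ y∈)
      ... | earlier x∈ e | _ = x∈ , e
      ... | last _ e | last y≡v _ = contradiction y≡v (x∈p-y⇒x≢y y∈)
      ... | last _ e | earlier _ e′ =
        contradiction (<-trans (subst₂ ℕ._<_ e e′ lt) (bounded y∈)) (<-irrefl refl)

      injective′ : ∀ {a b} → a ∈ S → b ∈ S → pos′ a ≡ pos′ b → a ≡ b
      injective′ a∈S b∈S eq with placed a∈S | placed b∈S
      ... | last a≡v _ | last b≡v _ = trans a≡v (sym b≡v)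
      ... | last _ e | earlier b∈ e′ = contradiction (trans (sym eq) e) (earlier-not-last b∈ e′)
      ... | earlier a∈ e | last _ e′ = contradiction (trans eq e′) (earlier-not-last a∈ e)
      ... | earlier a∈ e | earlier b∈ e′ = injective a∈ b∈ (trans (sym e) (trans eq e′))

      bounded′ : ∀ {a} → a ∈ S → pos′ a ℕ.< ∣ S ∣
      bounded′ a∈S with placed a∈S
      ... | last _ e = subst (ℕ._< ∣ S ∣) (sym e) (x∈p⇒∣p-x∣<∣p∣ v∈S)
      ... | earlier a∈ e = subst (ℕ._< ∣ S ∣) (sym e) (<-trans (bounded a∈) (x∈p⇒∣p-x∣<∣p∣ v∈S))

      perfect′ : ∀ {x a b} → x ∈ S → a ∈ S → b ∈ S → Adj G a x → Adj G b x
               → pos′ a ℕ.< pos′ x → pos′ b ℕ.< pos′ x → a ≢ b → Adj G a b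
      perfect′ x∈S a∈S b∈S a~x b~x a<x b<x a≢b with placed x∈S
      ... | last refl _ = simplicial a∈S b∈S a~x b~x a≢b
      ... | earlier x∈ e with earlier-before a∈S x∈ a<x | earlier-before b∈S x∈ b<x
      ...   | a∈ , ea | b∈ , eb =
        perfect x∈ a∈ b∈ a~x b~x (subst₂ ℕ._<_ ea e a<x) (subst₂ ℕ._<_ eb e b<x) a≢b

    comesFirst-extend : ∀ {B} → B ⊆ S - v → EliminationOrder (S - v) pos
                      → ComesFirst B (S - v) pos → ComesFirst B S (placeLast v ∣ S - v ∣ pos)
    comesFirst-extend {B} B⊆S-v eo first {b} {x} b∈B x∈S x∉B
      rewrite placeLast-other {k = ∣ S - v ∣} {pos} (x∈p-y⇒x≢y (B⊆S-v b∈B)) with placed x∈S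
    ... | last _ e = subst (pos b ℕ.<_) (sym e) (EliminationOrder.bounded eo (B⊆S-v b∈B))
    ... | earlier x∈ e = subst (pos b ℕ.<_) (sym e) (first b∈B x∈ x∉B)

  elimination-order⇒peo : ∀ {pos} → EliminationOrder ⊤ pos
    → Σ (Fin n → Fin n) λ pos′ → IsPEO G pos′ × (∀ {a b} → pos a ℕ.< pos b → pos′ a < pos′ b)
  elimination-order⇒peo {pos} eo =
    pos′ , (injective′ , perfect′) , λ {a} {b} → subst₂ ℕ._<_ (sym (toℕ-pos′ a)) (sym (toℕ-pos′ b))
    where
    open EliminationOrder eo

    pos′ : Fin n → Fin n
    pos′ x = fromℕ< (subst (pos x ℕ.<_) (∣⊤∣≡n n) (bounded ∈⊤))

    toℕ-pos′ : ∀ x → toℕ (pos′ x) ≡ pos x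
    toℕ-pos′ x = toℕ-fromℕ< _

    injective′ : Injective _≡_ _≡_ pos′
    injective′ {a} {b} e = injective ∈⊤ ∈⊤ (trans (sym (toℕ-pos′ a)) (trans (cong toℕ e) (toℕ-pos′ b)))

    perfect′ : ∀ v a b → Adj G a v → Adj G b v → pos′ a < pos′ v → pos′ b < pos′ v → a ≢ b → Adj G a b
    perfect′ v a b a~v b~v a<v b<v = perfect ∈⊤ ∈⊤ ∈⊤ a~v b~v
      (subst₂ ℕ._<_ (toℕ-pos′ a) (toℕ-pos′ v) a<v) (subst₂ ℕ._<_ (toℕ-pos′ b) (toℕ-pos′ v) b<v)

  module _ (chordal : Chordal G) where

    detour⇒adj : ∀ {u p q} → Adj G u p → Adj G u q → p ≢ q → WalkIn G (Detour u p q) p q → Adj G p q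
    detour⇒adj u~p u~q p≢q walk with walk⇒chordless walk
    ... | vs , path , onDetour =
      subst (Adj G _) (chordless-lookup-last path)
        (consecutive⇒chordless-adj path zero (fromℕ (length vs)) (inj₁ (sym second-is-last)))
      where
      second-is-last : toℕ (fromℕ (length vs)) ≡ 1
      second-is-last = trans (toℕ-fromℕ _)
        (suc-injective (suc-injective (chordal _ _ (detour-cycle path u~p u~q p≢q onDetour))))

    module Separation {S : Subset n} {u w : Vertex} (u∈S : u ∈ S) (w∈S : w ∈ S) (w-far : ¬ Near u w) where

      outside? : Decidable (λ x → x ∈ S × ¬ Near u x)
      outside? x = x ∈? S ×-dec ¬? (near? u x)

      open Component (component (∈⟦⟧⁺ outside? (w∈S , w-far))) renaming (members to K)

      K-outside : ∀ {x} → x ∈ K → x ∈ S × ¬ Near u x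
      K-outside x∈K = ∈⟦⟧⁻ outside? (walk-end (walk x∈K))

      boundary? : Decidable (λ x → x ∈ S × x ∉ K × ∃[ k ] k ∈ K × Adj G k x)
      boundary? x = x ∈? S ×-dec ¬? (x ∈? K) ×-dec any? (λ k → k ∈? K ×-dec adj? k x)

      boundary : Subset n
      boundary = ⟦ boundary? ⟧

      boundary-adj : ∀ {x} → x ∈ boundary → Adj G u x
      boundary-adj {x} x∈B with ∈⟦⟧⁻ boundary? x∈B | near? u x
      ... | _ , _ , k , k∈K , k~x | yes (inj₁ refl) =
        contradiction (inj₂ (adj-sym k~x)) (proj₂ (K-outside k∈K))
      ... | _ , _ , _ , _ , _ | yes (inj₂ u~x) = u~x
      ... | x∈S , x∉K , k , k∈K , k~x | no x-far =
        contradiction (closed k∈K (∈⟦⟧⁺ outside? (x∈S , x-far)) k~x) x∉K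

      boundary-clique : IsClique boundary
      boundary-clique {p} {q} p∈B q∈B p≢q with ∈⟦⟧⁻ boundary? p∈B | ∈⟦⟧⁻ boundary? q∈B
      ... | _ , _ , kp , kp∈K , kp~p | _ , _ , kq , kq∈K , kq~q =
        detour⇒adj (boundary-adj p∈B) (boundary-adj q∈B) p≢q
          (step (inj₁ refl) (adj-sym kp~p)
            (walk-map detour (walk-reverse (walk kp∈K) ++ʷ walk kq∈K)
              ++ʷ step (detour (walk-end (walk kq∈K))) kq~q (here (inj₂ (inj₁ refl)))))
        where
        detour : ∀ {x} → x ∈ ⟦ outside? ⟧ → Detour u p q x
        detour x∈ = inj₂ (inj₂ (proj₂ (∈⟦⟧⁻ outside? x∈)))

      inner : Subset n
      inner = K ∪ boundary

      inner⊂S : inner ⊂ S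
      inner⊂S = inner⊆S , u , u∈S , u∉inner
        where
        inner⊆S : inner ⊆ S
        inner⊆S x∈ with x∈p∪q⁻ K boundary x∈
        ... | inj₁ x∈K = proj₁ (K-outside x∈K)
        ... | inj₂ x∈B = proj₁ (∈⟦⟧⁻ boundary? x∈B)

        u∉inner : u ∉ inner
        u∉inner u∈ with x∈p∪q⁻ K boundary u∈
        ... | inj₁ u∈K = proj₂ (K-outside u∈K) (inj₁ refl)
        ... | inj₂ u∈B = adj-irrefl (boundary-adj u∈B)

      inner-∖-boundary : ∀ {x} → x ∈ inner → x ∉ boundary → x ∈ K
      inner-∖-boundary {x} x∈inner x∉B with x∈p∪q⁻ K boundary x∈inner
      ... | inj₁ x∈K = x∈K
      ... | inj₂ x∈B = contradiction x∈B x∉B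

      K-nbhd⊆inner : ∀ {a v} → v ∈ K → a ∈ S → Adj G a v → a ∈ inner
      K-nbhd⊆inner {a} {v} v∈K a∈S a~v with a ∈? K
      ... | yes a∈K = p⊆p∪q boundary a∈K
      ... | no a∉K = q⊆p∪q K boundary (∈⟦⟧⁺ boundary? (a∈S , a∉K , v , v∈K , adj-sym a~v))

      simplicial-in-component : DiracProperty inner → ∀ {C} → Dominates u C
                              → ∃[ v ] v ∈ S × v ∉ C × Simplicial S v
      simplicial-in-component dirac-inner C⊆N[u] =
        let v , v∈inner , v∉B , simplicial = dirac-inner {boundary} (q⊆p∪q K boundary) boundary-clique
                                                         (p⊆p∪q boundary root) root∉boundary
            v∈K = inner-∖-boundary v∈inner v∉B
        in v , proj₁ (K-outside v∈K) , proj₂ (K-outside v∈K) ∘ C⊆N[u] ,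
           simplicial-⊆ (K-nbhd⊆inner v∈K) simplicial
        where
        root∉boundary : w ∉ boundary
        root∉boundary w∈B = proj₁ (proj₂ (∈⟦⟧⁻ boundary? w∈B)) root

    dirac : ∀ S → DiracProperty S
    dirac S = go (⊂-wellFounded S)
      where
      go : ∀ {S} → Acc _⊂_ S → DiracProperty S
      go {S} (acc rec) C⊆S clique w∈S w∉C with clique-dominator C⊆S clique w∈S
      ... | u , u∈S , C⊆N[u] with dominates? S u
      ...   | inj₁ dominates = dirac-dominating dominates (go (rec (x∈p⇒p-x⊂p u∈S))) C⊆S clique w∈S w∉C
      ...   | inj₂ (w′ , w′∈S , w′-far) =
        let open Separation u∈S w′∈S w′-far in simplicial-in-component (go (rec inner⊂S)) C⊆N[u]

    elimination-order : ∀ S → ∃[ pos ] EliminationOrder S pos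
    elimination-order S = go (⊂-wellFounded S)
      where
      go : ∀ {S} → Acc _⊂_ S → ∃[ pos ] EliminationOrder S pos
      go {S} (acc rec) with nonempty? S
      ... | no empty = _ , empty-elimination-order (λ x∈S → empty (_ , x∈S))
      ... | yes (w , w∈S) with dirac S (λ x∈∅ → contradiction x∈∅ ∉⊥) (λ x∈∅ → contradiction x∈∅ ∉⊥) w∈S ∉⊥
      ...   | v , v∈S , _ , simplicial with go (rec (x∈p⇒p-x⊂p v∈S))
      ...     | pos , eo = _ , extend v∈S simplicial eo

    module _ {B : Subset n}
             (simplicial-outside : ∀ {S w} → w ∈ S → w ∉ B → ∃[ v ] v ∈ S × v ∉ B × Simplicial S v) where

      elimination-order-from : ∀ {S} → B ⊆ S → ∃[ pos ] EliminationOrder S pos × ComesFirst B S pos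
      elimination-order-from {S} = go (⊂-wellFounded S)
        where
        go : ∀ {S} → Acc _⊂_ S → B ⊆ S → ∃[ pos ] EliminationOrder S pos × ComesFirst B S pos
        go {S} (acc rec) B⊆S with any? (λ x → x ∈? S ×-dec ¬? (x ∈? B))
        ... | no S⊆B =
          let pos , eo = elimination-order S in pos , eo , λ _ x∈S x∉B → contradiction (_ , x∈S , x∉B) S⊆B
        ... | yes (w , w∈S , w∉B) with simplicial-outside w∈S w∉B
        ...   | v , v∈S , v∉B , simplicial with go (rec (x∈p⇒p-x⊂p v∈S)) (p⊆q⇒p⊆q-x B⊆S v∉B)
        ...     | pos , eo , first =
          _ , extend v∈S simplicial eo , comesFirst-extend v∈S (p⊆q⇒p⊆q-x B⊆S v∉B) eo first

    simplicial-outside-cut : ∀ {B c} → c ∈ B → (∀ {b x} → b ∈ B → x ∉ B → Adj G b x → b ≡ c)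
      → ∀ {S w} → w ∈ S → w ∉ B → ∃[ v ] v ∈ S × v ∉ B × Simplicial S v
    simplicial-outside-cut {B} {c} c∈B cut {S} {w} w∈S w∉B =
      let v , v∈S′ , v∉⁅c⁆ , simplicial = dirac ((S ─ B) ∪ ⁅ c ⁆) {⁅ c ⁆} (q⊆p∪q _ _) singleton-clique
                                                (p⊆p∪q _ (x∈p∧x∉q⇒x∈p─q w∈S w∉B)) w∉⁅c⁆
          v∈S─B = outside-singleton v∈S′ v∉⁅c⁆
      in v , p─q⊆p _ _ v∈S─B , x∈p─q⇒x∉q v∈S─B , simplicial-⊆ (nbhd⊆S′ v∈S─B) simplicial
      where
      singleton-clique : IsClique ⁅ c ⁆
      singleton-clique a∈ b∈ a≢b = contradiction (trans (x∈⁅y⁆⇒x≡y c a∈) (sym (x∈⁅y⁆⇒x≡y c b∈))) a≢b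

      w∉⁅c⁆ : w ∉ ⁅ c ⁆
      w∉⁅c⁆ w∈⁅c⁆ = w∉B (subst (_∈ B) (sym (x∈⁅y⁆⇒x≡y c w∈⁅c⁆)) c∈B)

      outside-singleton : ∀ {v} → v ∈ (S ─ B) ∪ ⁅ c ⁆ → v ∉ ⁅ c ⁆ → v ∈ S ─ B
      outside-singleton v∈S′ v∉⁅c⁆ with x∈p∪q⁻ (S ─ B) ⁅ c ⁆ v∈S′
      ... | inj₁ v∈S─B = v∈S─B
      ... | inj₂ v∈⁅c⁆ = contradiction v∈⁅c⁆ v∉⁅c⁆

      nbhd⊆S′ : ∀ {v a} → v ∈ S ─ B → a ∈ S → Adj G a v → a ∈ (S ─ B) ∪ ⁅ c ⁆
      nbhd⊆S′ {v} {a} v∈S─B a∈S a~v with a ∈? B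
      ... | yes a∈B = q⊆p∪q _ _ (subst (_∈ ⁅ c ⁆) (sym (cut a∈B (x∈p─q⇒x∉q v∈S─B) a~v)) (x∈⁅x⁆ c))
      ... | no a∉B = p⊆p∪q _ (x∈p∧x∉q⇒x∈p─q a∈S a∉B)

module _ {n m : ℕ} (f : Fin m → Fin n) where

  image? : Decidable (λ v → ∃[ a ] f a ≡ v)
  image? v = any? (λ a → f a ≟ᶠ v)

  image : Subset n
  image = ⟦ image? ⟧

  ∈-image : ∀ a → f a ∈ image
  ∈-image a = ∈⟦⟧⁺ image? (a , refl)

  ∉-image⁺ : ∀ {v} → (∀ a → f a ≢ v) → v ∉ image
  ∉-image⁺ v∉f v∈ = let a , fa≡v = ∈⟦⟧⁻ image? v∈ in v∉f a fa≡v

  ∉-image⁻ : ∀ {v} → v ∉ image → ∀ a → f a ≢ v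
  ∉-image⁻ v∉ a fa≡v = v∉ (∈⟦⟧⁺ image? (a , fa≡v))

appendix-attached-at : ∀ {n m} (G : Graph n) (H : Graph m) (x : Fin m) (f : Fin m → Fin n)
  → HasAppendix G H x f → ∀ {b y} → b ∈ image f → y ∉ image f → Adj G b y → b ≡ f x
appendix-attached-at G H x f (_ , _ , attached , _) {b} {y} b∈H y∉H b~y with ∈⟦⟧⁻ (image? f) b∈H
... | a , refl with a ≟ᶠ x
...   | yes a≡x = cong f a≡x
...   | no a≢x with trans (sym b~y) (attached a y a≢x (∉-image⁻ f y∉H))
...     | ()

lemma33 : ∀ {n m} (G : Graph n) (H : Graph m) (x : Fin m) (f : Fin m → Fin n)
    → TwoConnected H
    → TwoConnectedOn H (λ v → v ≢ x) ⊎ SingleEdgeOn H (λ v → v ≢ x)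
    → HasAppendix G H x f
    → Chordal G
    → Σ (Fin n → Fin n) λ pos → IsPEO G pos
        × (∀ a v → (∀ b → f b ≢ v) → pos (f a) < pos v)
lemma33 G H x f _ _ appendix chordal =
  let simplicial-outside-H =
        simplicial-outside-cut G chordal (∈-image f x) (appendix-attached-at G H x f appendix)
      pos , eo , H-first = elimination-order-from G chordal simplicial-outside-H ⊆⊤
      pos′ , peo , pos′-monotone = elimination-order⇒peo G eo
  in pos′ , peo , λ a v v∉H → pos′-monotone (H-first (∈-image f a) ∈⊤ (∉-image⁺ f v∉H))
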